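{- Let $r$ and $t$ be positive integers. If $r$ and $t$ have the same parity, then $$\gamma_o(K_{r}\Box K_{t})= \left\lceil\frac{rt}{2}\right\rceil.$$ If $r$ and $t$ have different parity, then $$\left\lceil\frac{rt(r+t-1)}{2(r+t)}\right\rceil \le \gamma_o(K_{r}\Box K_{t})\le \left\lceil\frac{rt}{2}\right\rceil.$$
   Context: All graphs are finite and simple; $K_n$ is the complete graph on $n$ vertices. For a graph with vertex set $V$, a vertex $v$ and $S\subseteq V$, let $\delta_S(v)=|N(v)\cap S|$ and $\overline{S}=V\setminus S$. A nonempty set $S\subseteq V$ is a global offensive alliance if $\delta_S(v)\ge \delta_{\overline{S}}(v)+1$ for every $v\in\overline{S}$; $\gamma_o(G)$ is the minimum cardinality of a global offensive alliance of $G$. $G\Box H$ is the Cartesian product: vertex set $V(G)\times V(H)$, with $(a,b)\sim(c,d)$ iff ($a=c$ and $b\sim d$ in $H$) or ($a\sim c$ in $G$ and $b=d$). -}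

module Defs where

open import Data.Nat using (ℕ; zero; suc; _+_; _*_; _≤_; _/_)
open import Data.Bool using (Bool; not; _∧_; _∨_)
open import Data.Fin using (Fin; remQuot; _≟_)
open import Data.Fin.Subset using (Subset; _∈_; _∉_; ∁; _∩_; ∣_∣; Nonempty)
open import Data.Vec using (tabulate)
open import Data.Product using (_×_; _,_; Σ)
open import Relation.Nullary.Decidable using (⌊_⌋)
open import Relation.Binary.PropositionalEquality using (_≡_)

Graph : ℕ → Set
Graph n = Fin n → Fin n → Bool

K : (n : ℕ) → Graph n
K n i j = not ⌊ i ≟ j ⌋

-- Cartesian product G □ H; vertex (a , b) is encoded as combine a b
-- (decoded with remQuot).
_□_ : {m n : ℕ} → Graph m → Graph n → Graph (m * n)
_□_ {m} {n} G H i j with remQuot {m} n i | remQuot {m} n j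
... | a , b | c , d = (⌊ a ≟ c ⌋ ∧ H b d) ∨ (G a c ∧ ⌊ b ≟ d ⌋)

N : {n : ℕ} → Graph n → Fin n → Subset n
N G v = tabulate (G v)

δ : {n : ℕ} → Graph n → Subset n → Fin n → ℕ
δ G S v = ∣ N G v ∩ S ∣

IsGlobalOffensiveAlliance : {n : ℕ} → Graph n → Subset n → Set
IsGlobalOffensiveAlliance G S =
  Nonempty S × (∀ v → v ∉ S → suc (δ G (∁ S) v) ≤ δ G S v)

IsGammaO : {n : ℕ} → Graph n → ℕ → Set
IsGammaO {n} G k =
  Σ (Subset n) (λ S → IsGlobalOffensiveAlliance G S × ∣ S ∣ ≡ k)
  × (∀ S → IsGlobalOffensiveAlliance G S → k ≤ ∣ S ∣)

-- ⌈a / b⌉ for b ≥ 1 (value 0 for b = 0, never used)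
⌈_/_⌉ : ℕ → ℕ → ℕ
⌈ a / zero ⌉ = 0
⌈ a / suc b ⌉ = (a + b) / suc b

-- Identify S ⊆ V(K_r □ K_t) with an r × t 0/1 matrix with row sums Rₐ and column sums C_b.
-- A vertex (a, b) ∉ S has Rₐ + C_b neighbours in S and (t − Rₐ) + (r − C_b) − 2 outside, so
-- S is offensive there iff r + t ≤ 1 + 2 (Rₐ + C_b). Summing 2 (Rₐ + C_b) ≥ p over the n̄
-- non-members gives n̄ p ≤ 2 (∑ Rₐ (t − Rₐ) + ∑ C_b (r − C_b)), and Chebyshev's sum inequality
-- bounds each of these sums by |S| n̄ / r and |S| n̄ / t. Hence r t p ≤ 2 (r + t) |S|, where
-- p = r + t − 1 in general and p = r + t when r + t is even. The checkerboard
-- {(a, b) : a ≡ b (mod 2)} is an alliance with ⌈r t / 2⌉ vertices.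

module Submission where

open import Defs
open import Data.Nat
  using (ℕ; zero; suc; _+_; _*_; _∸_; _≤_; _<_; _%_; _/_; NonZero; z≤n; s≤s; s≤s⁻¹; z<s;
         parity; ⌊_/2⌋; ⌈_/2⌉; >-nonZero; >-nonZero⁻¹)
open import Data.Nat.Properties hiding (_≟_)
open import Data.Nat.DivMod using (m≡m%n+[m/n]*n; m<n*o⇒m/o<n; /-monoˡ-≤; m*n/n≡m)
open import Data.Nat.Tactic.RingSolver using (solve-∀)
open import Algebra.Properties.Semiring.Sum +-*-semiring
  using (sum; sum-syntax; sum-cong-≗; ∑-distrib-+; ∑-comm; *-distribˡ-sum; *-distribʳ-sum)
open import Data.Bool using (Bool; true; false; not; _∧_; _∨_; _xor_; if_then_else_)
open import Data.Bool.Properties using (¬-not)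
open import Data.Fin using (Fin; zero; suc; toℕ; combine; remQuot; _↑ˡ_; _↑ʳ_)
open import Data.Fin.Properties using (_≟_; remQuot-combine; combine-remQuot)
open import Data.Fin.Subset using (Subset; ∣_∣; ∁; _∩_; _∉_; Nonempty)
open import Data.Parity.Base using (Parity; 0ℙ; 1ℙ)
import Data.Parity.Properties as ℙ
open import Data.Vec using ([]; _∷_; lookup; tabulate)
open import Data.Vec.Properties
  using (lookup-zipWith; lookup∘tabulate; lookup-map; []=⇒lookup; lookup⇒[]=)
open import Data.Product using (_×_; _,_; proj₂; uncurry)
open import Data.Sum using ([_,_]′)
open import Function using (_∘_; _⇔_; mk⇔; Equivalence)
open import Relation.Nullary using (does)
open import Relation.Nullary.Decidable using (⌊_⌋; isYes≗does)
open import Relation.Binary.PropositionalEquality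
  using (_≡_; _≢_; refl; sym; trans; cong; cong₂; subst; subst₂; module ≡-Reasoning)

rearrangement : ∀ x u y w → x + u ≡ y + w → x * u + y * w ≤ x * w + y * u
rearrangement x u y w e =
  [ ordered e
  , (λ y≤x → subst₂ _≤_ (+-comm (y * w) (x * u)) (+-comm (y * u) (x * w)) (ordered (sym e) y≤x))
  ]′ (≤-total x y)
  where
  ordered : ∀ {x u y w} → x + u ≡ y + w → x ≤ y → x * u + y * w ≤ x * w + y * u
  ordered {x} {u} {y} {w} e x≤y with y ∸ x | m+[n∸m]≡n x≤y
  ... | d | refl with +-cancelˡ-≡ x u (d + w) (trans e (+-assoc x d w))
  ... | refl = subst (x * (d + w) + (x + d) * w ≤_) (gap x d w) (m≤m+n _ (d * d))
    where
    gap : ∀ x d w → x * (d + w) + (x + d) * w + d * d ≡ x * w + (x + d) * (d + w)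
    gap = solve-∀

1+n≤m⇔m+[n+2]≤1+2m : ∀ m n → suc n ≤ m ⇔ m + (n + 2) ≤ 1 + 2 * m
1+n≤m⇔m+[n+2]≤1+2m m n = mk⇔
  (λ 1+n≤m → subst₂ _≤_ (sym (lhs m n)) (sym (rhs m)) (s≤s (+-monoʳ-≤ m 1+n≤m)))
  (λ ≤1+2m → +-cancelˡ-≤ m (suc n) m (s≤s⁻¹ (subst₂ _≤_ (lhs m n) (rhs m) ≤1+2m)))
  where
  lhs : ∀ m n → m + (n + 2) ≡ suc (m + suc n)
  lhs = solve-∀
  rhs : ∀ m → 1 + 2 * m ≡ suc (m + m)
  rhs = solve-∀

2k≤1+2z⇒2k≤2z : ∀ k z → 2 * k ≤ 1 + 2 * z → 2 * k ≤ 2 * z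
2k≤1+2z⇒2k≤2z k z 2k≤ =
  *-monoʳ-≤ 2 (s≤s⁻¹ (*-cancelˡ-< 2 k (suc z) (subst (suc (2 * k) ≤_) (double-suc z) (s≤s 2k≤))))
  where
  double-suc : ∀ z → suc (1 + 2 * z) ≡ 2 * suc z
  double-suc = solve-∀

same-%2⇒+-even : ∀ {r t} → r % 2 ≡ t % 2 → r + t ≡ 2 * (r % 2 + (r / 2 + t / 2))
same-%2⇒+-even {r} {t} r≡t = begin
  r + t
    ≡⟨ cong₂ _+_ (m≡m%n+[m/n]*n r 2) (m≡m%n+[m/n]*n t 2) ⟩
  (r % 2 + r / 2 * 2) + (t % 2 + t / 2 * 2)
    ≡⟨ cong (λ e → (r % 2 + r / 2 * 2) + (e + t / 2 * 2)) (sym r≡t) ⟩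
  (r % 2 + r / 2 * 2) + (r % 2 + t / 2 * 2)
    ≡⟨ collect (r % 2) (r / 2) (t / 2) ⟩
  2 * (r % 2 + (r / 2 + t / 2)) ∎
  where
  open ≡-Reasoning
  collect : ∀ e x y → (e + x * 2) + (e + y * 2) ≡ 2 * (e + (x + y))
  collect = solve-∀

⌈n/2⌉≤1+⌊n/2⌋ : ∀ n → ⌈ n /2⌉ ≤ suc ⌊ n /2⌋
⌈n/2⌉≤1+⌊n/2⌋ n = ⌊n/2⌋-mono (n≤1+n (suc n))

n≤⌈n/2⌉+⌈n/2⌉ : ∀ n → n ≤ ⌈ n /2⌉ + ⌈ n /2⌉
n≤⌈n/2⌉+⌈n/2⌉ n = subst (_≤ ⌈ n /2⌉ + ⌈ n /2⌉) (⌊n/2⌋+⌈n/2⌉≡n n) (+-monoˡ-≤ ⌈ n /2⌉ (⌊n/2⌋≤⌈n/2⌉ n))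

n≤1+⌊n/2⌋+⌊n/2⌋ : ∀ n → n ≤ suc (⌊ n /2⌋ + ⌊ n /2⌋)
n≤1+⌊n/2⌋+⌊n/2⌋ n = subst₂ _≤_ (⌊n/2⌋+⌈n/2⌉≡n n) (+-suc ⌊ n /2⌋ ⌊ n /2⌋)
  (+-monoʳ-≤ ⌊ n /2⌋ (⌈n/2⌉≤1+⌊n/2⌋ n))

⌈/⌉≤ : ∀ {a b k} → 0 < b → a ≤ b * k → ⌈ a / b ⌉ ≤ k
⌈/⌉≤ {a} {suc b} {k} _ a≤ = s≤s⁻¹ (m<n*o⇒m/o<n {a + b} {suc k} {suc b} (begin-strict
  a + b               ≤⟨ +-monoˡ-≤ b a≤ ⟩
  suc b * k + b       <⟨ n<1+n _ ⟩
  suc (suc b * k + b) ≡⟨ expand k b ⟩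
  suc k * suc b       ∎))
  where
  open ≤-Reasoning
  expand : ∀ k b → suc (suc b * k + b) ≡ suc k * suc b
  expand = solve-∀

≤⌈/2⌉ : ∀ {a c} → 2 * c ≤ suc a → c ≤ ⌈ a / 2 ⌉
≤⌈/2⌉ {a} {c} 2c≤ = subst (_≤ (a + 1) / 2) (m*n/n≡m c 2)
  (/-monoˡ-≤ 2 (subst₂ _≤_ (*-comm 2 c) (+-comm 1 a) 2c≤))

iverson : Bool → ℕ
iverson true  = 1
iverson false = 0

iverson-not : ∀ x → iverson x + iverson (not x) ≡ 1
iverson-not true  = refl
iverson-not false = refl

∑-mono-≤ : ∀ {n} {f g : Fin n → ℕ} → (∀ i → f i ≤ g i) → sum f ≤ sum g
∑-mono-≤ {zero}  f≤g = z≤n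
∑-mono-≤ {suc n} f≤g = +-mono-≤ (f≤g zero) (∑-mono-≤ (f≤g ∘ suc))

∑-const : ∀ n c → ∑[ i < n ] c ≡ n * c
∑-const zero    c = refl
∑-const (suc n) c = cong (c +_) (∑-const n c)

∑∑-distrib-+ : ∀ {m n} (f g : Fin m → Fin n → ℕ) →
  ∑[ i < m ] ∑[ j < n ] (f i j + g i j) ≡ ∑[ i < m ] ∑[ j < n ] f i j + ∑[ i < m ] ∑[ j < n ] g i j
∑∑-distrib-+ f g =
  trans (sum-cong-≗ (λ i → ∑-distrib-+ (f i) (g i))) (∑-distrib-+ (λ i → sum (f i)) (λ i → sum (g i)))

∑∑-*ˡ : ∀ {m n} c (f : Fin m → Fin n → ℕ) →
  ∑[ i < m ] ∑[ j < n ] (c * f i j) ≡ c * ∑[ i < m ] ∑[ j < n ] f i j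
∑∑-*ˡ c f =
  trans (sum-cong-≗ (λ i → sym (*-distribˡ-sum c (f i)))) (sym (*-distribˡ-sum c (λ i → sum (f i))))

∑-iverson-not : ∀ {n} (f : Fin n → Bool) →
  ∑[ i < n ] iverson (f i) + ∑[ i < n ] iverson (not (f i)) ≡ n
∑-iverson-not {n} f = begin
  ∑[ i < n ] iverson (f i) + ∑[ i < n ] iverson (not (f i))
    ≡⟨ ∑-distrib-+ (iverson ∘ f) (iverson ∘ not ∘ f) ⟨
  ∑[ i < n ] (iverson (f i) + iverson (not (f i)))  ≡⟨ sum-cong-≗ (iverson-not ∘ f) ⟩
  ∑[ i < n ] 1                                      ≡⟨ ∑-const n 1 ⟩
  n * 1                                             ≡⟨ *-identityʳ n ⟩
  n                                                 ∎
  where open ≡-Reasoning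

∑-if : ∀ {n} α (f : Fin n → ℕ) → ∑[ i < n ] (if α then f i else 0) ≡ (if α then sum f else 0)
∑-if     true  f = refl
∑-if {n} false f = trans (∑-const n 0) (*-zeroʳ n)

∑-δ : ∀ {n} (a : Fin n) (f : Fin n → ℕ) → ∑[ c < n ] (if does (a ≟ c) then f c else 0) ≡ f a
∑-δ {suc n} zero    f = trans (cong (f zero +_) (∑-if false (f ∘ suc))) (+-identityʳ (f zero))
∑-δ {suc n} (suc a) f = ∑-δ a (f ∘ suc)

∑-↑ : ∀ m n (f : Fin (m + n) → ℕ) → sum f ≡ ∑[ i < m ] f (i ↑ˡ n) + ∑[ j < n ] f (m ↑ʳ j)
∑-↑ zero    n f = refl
∑-↑ (suc m) n f = trans (cong (f zero +_) (∑-↑ m n (f ∘ suc))) (sym (+-assoc (f zero) _ _))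

∑-combine : ∀ m n (f : Fin (m * n) → ℕ) → sum f ≡ ∑[ i < m ] ∑[ j < n ] f (combine i j)
∑-combine zero    n f = refl
∑-combine (suc m) n f =
  trans (∑-↑ n (m * n) f) (cong (∑[ j < n ] f (j ↑ˡ (m * n)) +_) (∑-combine m n (f ∘ (n ↑ʳ_))))

∣p∣≡∑ : ∀ {n} (p : Subset n) → ∣ p ∣ ≡ ∑[ i < n ] iverson (lookup p i)
∣p∣≡∑ []          = refl
∣p∣≡∑ (true  ∷ p) = cong suc (∣p∣≡∑ p)
∣p∣≡∑ (false ∷ p) = ∣p∣≡∑ p

chebyshev : ∀ {n t} (x u : Fin n → ℕ) → (∀ i → x i + u i ≡ t) →
  n * ∑[ i < n ] (x i * u i) ≤ sum x * sum u
chebyshev {zero}  x u e = z≤n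
chebyshev {suc n} x u e = begin
  suc n * (x₀ * u₀ + P)                   ≡⟨ regroup n (x₀ * u₀) P ⟩
  x₀ * u₀ + (P + n * (x₀ * u₀)) + n * P   ≤⟨ +-mono-≤ (+-monoʳ-≤ (x₀ * u₀) cross)
                                                       (chebyshev (x ∘ suc) (u ∘ suc) (e ∘ suc)) ⟩
  x₀ * u₀ + (Σx * u₀ + x₀ * Σu) + Σx * Σu ≡⟨ expand x₀ u₀ Σx Σu ⟩
  (x₀ + Σx) * (u₀ + Σu)                   ∎
  where
  open ≤-Reasoning
  x₀ = x zero
  u₀ = u zero
  P  = ∑[ i < n ] (x (suc i) * u (suc i))
  Σx = ∑[ i < n ] x (suc i)
  Σu = ∑[ i < n ] u (suc i)
  regroup : ∀ n a c → suc n * (a + c) ≡ a + (c + n * a) + n * c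
  regroup = solve-∀
  expand : ∀ a b c d → a * b + (c * b + a * d) + c * d ≡ (a + c) * (b + d)
  expand = solve-∀
  cross : P + n * (x₀ * u₀) ≤ Σx * u₀ + x₀ * Σu
  cross = begin
    P + n * (x₀ * u₀)
      ≡⟨ cong (P +_) (∑-const n (x₀ * u₀)) ⟨
    P + ∑[ i < n ] (x₀ * u₀)
      ≡⟨ ∑-distrib-+ (λ i → x (suc i) * u (suc i)) (λ _ → x₀ * u₀) ⟨
    ∑[ i < n ] (x (suc i) * u (suc i) + x₀ * u₀)
      ≤⟨ ∑-mono-≤ (λ i → rearrangement _ _ x₀ u₀ (trans (e (suc i)) (sym (e zero)))) ⟩
    ∑[ i < n ] (x (suc i) * u₀ + x₀ * u (suc i))
      ≡⟨ ∑-distrib-+ (λ i → x (suc i) * u₀) (λ i → x₀ * u (suc i)) ⟩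
    ∑[ i < n ] (x (suc i) * u₀) + ∑[ i < n ] (x₀ * u (suc i))
      ≡⟨ cong₂ _+_ (*-distribʳ-sum u₀ (x ∘ suc)) (*-distribˡ-sum x₀ (u ∘ suc)) ⟨
    Σx * u₀ + x₀ * Σu ∎

∑-parity-≤ : ∀ r (f : Parity → ℕ) → f 0ℙ ≤ suc (f 1ℙ) →
  2 * ∑[ a < r ] f (parity (toℕ a)) ≤ suc (r * (f 0ℙ + f 1ℙ))
∑-parity-≤ zero          f _    = z≤n
∑-parity-≤ (suc zero)    f f₀≤ = subst₂ _≤_ (lhs (f 0ℙ)) (rhs (f 0ℙ) (f 1ℙ)) (+-monoʳ-≤ (f 0ℙ) f₀≤)
  where
  lhs : ∀ x → x + x ≡ 2 * (x + 0)
  lhs = solve-∀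
  rhs : ∀ x y → x + suc y ≡ suc (1 * (x + y))
  rhs = solve-∀
∑-parity-≤ (suc (suc r)) f f₀≤ =
  subst₂ _≤_ (sym (lhs (f 0ℙ) (f 1ℙ) _)) (rhs (f 0ℙ) (f 1ℙ) r)
    (+-monoʳ-≤ (2 * (f 0ℙ + f 1ℙ)) (∑-parity-≤ r f f₀≤))
  where
  lhs : ∀ x y s → 2 * (x + (y + s)) ≡ 2 * (x + y) + 2 * s
  lhs = solve-∀
  rhs : ∀ x y r → 2 * (x + y) + suc (r * (x + y)) ≡ suc (suc (suc r) * (x + y))
  rhs = solve-∀

does-≟-comm : ∀ p q → does (p ℙ.≟ q) ≡ does (q ℙ.≟ p)
does-≟-comm 0ℙ 0ℙ = refl
does-≟-comm 0ℙ 1ℙ = refl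
does-≟-comm 1ℙ 0ℙ = refl
does-≟-comm 1ℙ 1ℙ = refl

parityCount : ℕ → Parity → ℕ
parityCount n p = ∑[ d < n ] iverson (does (p ℙ.≟ parity (toℕ d)))

parityCount-0ℙ : ∀ n → parityCount n 0ℙ ≡ ⌈ n /2⌉
parityCount-0ℙ zero          = refl
parityCount-0ℙ (suc zero)    = refl
parityCount-0ℙ (suc (suc n)) = cong suc (parityCount-0ℙ n)

parityCount-1ℙ : ∀ n → parityCount n 1ℙ ≡ ⌊ n /2⌋
parityCount-1ℙ zero          = refl
parityCount-1ℙ (suc zero)    = refl
parityCount-1ℙ (suc (suc n)) = cong suc (parityCount-1ℙ n)

rowSum : ∀ {r t} → (Fin r → Fin t → Bool) → Fin r → ℕ
rowSum {t = t} h a = ∑[ b < t ] iverson (h a b)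

colSum : ∀ {r t} → (Fin r → Fin t → Bool) → Fin t → ℕ
colSum {r} h b = ∑[ a < r ] iverson (h a b)

crossSum : ∀ {r t} → (Fin r → Fin t → Bool) → Fin r → Fin t → ℕ
crossSum h a b = rowSum h a + colSum h b

complement : ∀ {r t} → (Fin r → Fin t → Bool) → Fin r → Fin t → Bool
complement h a b = not (h a b)

counting-arithmetic : ∀ {r t p s n̄ A B} → s + n̄ ≡ r * t → p ≤ 2 * (r + t) →
  n̄ * p ≤ 2 * (A + B) → r * A ≤ s * n̄ → t * B ≤ s * n̄ → r * t * p ≤ 2 * (r + t) * s
counting-arithmetic {r} {t} {p} {s} {zero} total p≤ _ _ _ = begin
  r * t * p             ≤⟨ *-monoʳ-≤ (r * t) p≤ ⟩
  r * t * (2 * (r + t)) ≡⟨ *-comm (r * t) _ ⟩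
  2 * (r + t) * (r * t) ≡⟨ cong (2 * (r + t) *_) (trans (sym (+-identityʳ s)) total) ⟨
  2 * (r + t) * s       ∎
  where open ≤-Reasoning
counting-arithmetic {r} {t} {p} {s} {n̄@(suc _)} {A} {B} _ _ weighted rows cols =
  *-cancelˡ-≤ n̄ (begin
  n̄ * (r * t * p)                 ≡⟨ shuffle n̄ r t p ⟩
  r * t * (n̄ * p)                 ≤⟨ *-monoʳ-≤ (r * t) weighted ⟩
  r * t * (2 * (A + B))           ≡⟨ distribute r t A B ⟩
  2 * (t * (r * A) + r * (t * B)) ≤⟨ *-monoʳ-≤ 2 (+-mono-≤ (*-monoʳ-≤ t rows) (*-monoʳ-≤ r cols)) ⟩
  2 * (t * (s * n̄) + r * (s * n̄)) ≡⟨ collect r t s n̄ ⟩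
  n̄ * (2 * (r + t) * s)           ∎)
  where
  open ≤-Reasoning
  shuffle : ∀ n r t p → n * (r * t * p) ≡ r * t * (n * p)
  shuffle = solve-∀
  distribute : ∀ r t A B → r * t * (2 * (A + B)) ≡ 2 * (t * (r * A) + r * (t * B))
  distribute = solve-∀
  collect : ∀ r t s n → 2 * (t * (s * n) + r * (s * n)) ≡ n * (2 * (r + t) * s)
  collect = solve-∀

non-member-count : ∀ {r t} (h : Fin r → Fin t → Bool) p →
  (∀ a b → h a b ≡ false → p ≤ 2 * crossSum h a b) →
  ∑[ a < r ] rowSum (complement h) a * p
  ≤ 2 * (∑[ a < r ] (rowSum h a * rowSum (complement h) a)
         + ∑[ b < t ] (colSum h b * colSum (complement h) b))
non-member-count {r} {t} h p attacked = begin
  ∑[ a < r ] rowSum h̄ a * p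
    ≡⟨ *-distribʳ-sum p (rowSum h̄) ⟩
  ∑[ a < r ] (rowSum h̄ a * p)
    ≡⟨ sum-cong-≗ (λ a → *-distribʳ-sum p (ῑ a)) ⟩
  ∑[ a < r ] ∑[ b < t ] (ῑ a b * p)
    ≤⟨ ∑-mono-≤ (λ a → ∑-mono-≤ (at a)) ⟩
  ∑[ a < r ] ∑[ b < t ] (ῑ a b * (2 * crossSum h a b))
    ≡⟨ sum-cong-≗ (λ a → sum-cong-≗ (λ b → double (ῑ a b) (rowSum h a) (colSum h b))) ⟩
  ∑[ a < r ] ∑[ b < t ] (2 * (ῑ a b * rowSum h a + ῑ a b * colSum h b))
    ≡⟨ ∑∑-*ˡ 2 (λ a b → ῑ a b * rowSum h a + ῑ a b * colSum h b) ⟩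
  2 * ∑[ a < r ] ∑[ b < t ] (ῑ a b * rowSum h a + ῑ a b * colSum h b)
    ≡⟨ cong (2 *_) (∑∑-distrib-+ (λ a b → ῑ a b * rowSum h a) (λ a b → ῑ a b * colSum h b)) ⟩
  2 * (∑[ a < r ] ∑[ b < t ] (ῑ a b * rowSum h a) + ∑[ a < r ] ∑[ b < t ] (ῑ a b * colSum h b))
    ≡⟨ cong (2 *_) (cong₂ _+_ rows cols) ⟩
  2 * (∑[ a < r ] (rowSum h a * rowSum h̄ a) + ∑[ b < t ] (colSum h b * colSum h̄ b)) ∎
  where
  open ≤-Reasoning
  h̄ = complement h
  ῑ : Fin r → Fin t → ℕ
  ῑ a b = iverson (h̄ a b)
  at : ∀ a b → ῑ a b * p ≤ ῑ a b * (2 * crossSum h a b)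
  at a b with h a b in eq
  ... | true  = z≤n
  ... | false = *-monoʳ-≤ 1 (attacked a b eq)
  double : ∀ i x y → i * (2 * (x + y)) ≡ 2 * (i * x + i * y)
  double = solve-∀
  rows : ∑[ a < r ] ∑[ b < t ] (ῑ a b * rowSum h a) ≡ ∑[ a < r ] (rowSum h a * rowSum h̄ a)
  rows = sum-cong-≗ (λ a → trans (sym (*-distribʳ-sum (rowSum h a) (ῑ a)))
                                 (*-comm (rowSum h̄ a) (rowSum h a)))
  cols : ∑[ a < r ] ∑[ b < t ] (ῑ a b * colSum h b) ≡ ∑[ b < t ] (colSum h b * colSum h̄ b)
  cols = trans (∑-comm (λ a b → ῑ a b * colSum h b))
               (sum-cong-≗ (λ b → trans (sym (*-distribʳ-sum (colSum h b) (λ a → ῑ a b)))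
                                        (*-comm (colSum h̄ b) (colSum h b))))

counting-bound : ∀ {r t} (h : Fin r → Fin t → Bool) p → p ≤ 2 * (r + t) →
  (∀ a b → h a b ≡ false → p ≤ 2 * crossSum h a b) →
  r * t * p ≤ 2 * (r + t) * ∑[ a < r ] rowSum h a
counting-bound {r} {t} h p p≤ attacked =
  counting-arithmetic {r} {t} {p} {s} {n̄} {A} {B} total p≤ (non-member-count h p attacked) rows cols
  where
  h̄ = complement h
  s = ∑[ a < r ] rowSum h a
  n̄ = ∑[ a < r ] rowSum h̄ a
  A = ∑[ a < r ] (rowSum h a * rowSum h̄ a)
  B = ∑[ b < t ] (colSum h b * colSum h̄ b)
  total : s + n̄ ≡ r * t
  total = trans (sym (∑-distrib-+ (rowSum h) (rowSum h̄)))
                (trans (sum-cong-≗ (λ a → ∑-iverson-not (h a))) (∑-const r t))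
  rows : r * A ≤ s * n̄
  rows = chebyshev (rowSum h) (rowSum h̄) (λ a → ∑-iverson-not (h a))
  cols : t * B ≤ s * n̄
  cols = subst₂ (λ x y → t * B ≤ x * y)
                (sym (∑-comm (λ a b → iverson (h a b)))) (sym (∑-comm (λ a b → iverson (h̄ a b))))
                (chebyshev (colSum h) (colSum h̄) (λ b → ∑-iverson-not (λ a → h a b)))

-- Vertex sets of K r □ K t as r × t matrices

cells : ∀ r t → Subset (r * t) → Fin r → Fin t → Bool
cells r t S a b = lookup S (combine a b)

cells-∁ : ∀ {r t} (S : Subset (r * t)) a b → cells r t (∁ S) a b ≡ not (cells r t S a b)
cells-∁ S a b = lookup-map (combine a b) not S

rowSum-∁ : ∀ {r t} (S : Subset (r * t)) a → rowSum (cells r t S) a + rowSum (cells r t (∁ S)) a ≡ t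
rowSum-∁ {r} {t} S a =
  trans (cong (rowSum h a +_) (sum-cong-≗ (cong iverson ∘ cells-∁ S a))) (∑-iverson-not (h a))
  where h = cells r t S

colSum-∁ : ∀ {r t} (S : Subset (r * t)) b → colSum (cells r t S) b + colSum (cells r t (∁ S)) b ≡ r
colSum-∁ {r} {t} S b =
  trans (cong (colSum h b +_) (sum-cong-≗ (λ (a : Fin r) → cong iverson (cells-∁ S a b))))
        (∑-iverson-not (λ a → h a b))
  where h = cells r t S

∣S∣≡∑rowSum : ∀ {r t} (S : Subset (r * t)) → ∣ S ∣ ≡ ∑[ a < r ] rowSum (cells r t S) a
∣S∣≡∑rowSum {r} {t} S = trans (∣p∣≡∑ S) (∑-combine r t (iverson ∘ lookup S))

∉⇒lookup≡false : ∀ {n} {S : Subset n} {v} → v ∉ S → lookup S v ≡ false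
∉⇒lookup≡false {S = S} {v} v∉S = ¬-not (v∉S ∘ lookup⇒[]= v S)

lookup≡false⇒∉ : ∀ {n} {S : Subset n} {v} → lookup S v ≡ false → v ∉ S
lookup≡false⇒∉ out v∈S with trans (sym ([]=⇒lookup v∈S)) out
... | ()

δ≡∑ : ∀ {n} (G : Graph n) S v → δ G S v ≡ ∑[ w < n ] iverson (G v w ∧ lookup S w)
δ≡∑ G S v = trans (∣p∣≡∑ (N G v ∩ S)) (sum-cong-≗ λ w → cong iverson
  (trans (lookup-zipWith _∧_ w (N G v) S) (cong (_∧ lookup S w) (lookup∘tabulate (G v) w))))

□-combine : ∀ {m n} (G : Graph m) (H : Graph n) a b c d →
  (G □ H) (combine a b) (combine c d) ≡ (⌊ a ≟ c ⌋ ∧ H b d) ∨ (G a c ∧ ⌊ b ≟ d ⌋)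
□-combine {m} {n} G H a b c d =
  cong₂ (λ (a , b) (c , d) → (⌊ a ≟ c ⌋ ∧ H b d) ∨ (G a c ∧ ⌊ b ≟ d ⌋))
        (remQuot-combine {m} {n} a b) (remQuot-combine {m} {n} c d)

xor-as-∨ : ∀ x y → (x ∧ not y) ∨ (not x ∧ y) ≡ x xor y
xor-as-∨ true  true  = refl
xor-as-∨ true  false = refl
xor-as-∨ false y     = refl

K□K-adjacent : ∀ {r t} (a c : Fin r) (b d : Fin t) →
  (K r □ K t) (combine a b) (combine c d) ≡ does (a ≟ c) xor does (b ≟ d)
K□K-adjacent {r} {t} a c b d
  rewrite □-combine (K r) (K t) a b c d | isYes≗does (a ≟ c) | isYes≗does (b ≟ d) =
  xor-as-∨ (does (a ≟ c)) (does (b ≟ d))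

iverson-xor : ∀ α β x →
  iverson ((α xor β) ∧ x) + (if α then (if β then 2 * iverson x else 0) else 0)
  ≡ (if α then iverson x else 0) + (if β then iverson x else 0)
iverson-xor true  true  true  = refl
iverson-xor true  true  false = refl
iverson-xor true  false x     = refl
iverson-xor false true  true  = refl
iverson-xor false true  false = refl
iverson-xor false false x     = refl

-- The neighbours of a vertex are the other vertices of its row and of its column; the
-- vertex itself is counted by both the row and the column sum.
δ-K□K : ∀ {r t} (S : Subset (r * t)) a b →
  δ (K r □ K t) S (combine a b) + 2 * iverson (cells r t S a b) ≡ crossSum (cells r t S) a b
δ-K□K {r} {t} S a b = begin
  δ (K r □ K t) S (combine a b) + 2 * iverson (h a b)
    ≡⟨ cong₂ _+_ δ≡∑∑ (sym corner) ⟩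
  ∑[ c < r ] ∑[ d < t ] iverson ((α c xor β d) ∧ h c d) + ∑[ c < r ] ∑[ d < t ] both c d
    ≡⟨ ∑∑-distrib-+ (λ c d → iverson ((α c xor β d) ∧ h c d)) both ⟨
  ∑[ c < r ] ∑[ d < t ] (iverson ((α c xor β d) ∧ h c d) + both c d)
    ≡⟨ sum-cong-≗ (λ c → sum-cong-≗ (λ d → iverson-xor (α c) (β d) (h c d))) ⟩
  ∑[ c < r ] ∑[ d < t ] (inRow c d + inCol c d)
    ≡⟨ ∑∑-distrib-+ inRow inCol ⟩
  ∑[ c < r ] ∑[ d < t ] inRow c d + ∑[ c < r ] ∑[ d < t ] inCol c d
    ≡⟨ cong₂ _+_ row col ⟩
  rowSum h a + colSum h b ∎
  where
  open ≡-Reasoning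
  h = cells r t S
  α : Fin r → Bool
  α c = does (a ≟ c)
  β : Fin t → Bool
  β d = does (b ≟ d)
  both inRow inCol : Fin r → Fin t → ℕ
  both  c d = if α c then (if β d then 2 * iverson (h c d) else 0) else 0
  inRow c d = if α c then iverson (h c d) else 0
  inCol c d = if β d then iverson (h c d) else 0
  δ≡∑∑ : δ (K r □ K t) S (combine a b) ≡ ∑[ c < r ] ∑[ d < t ] iverson ((α c xor β d) ∧ h c d)
  δ≡∑∑ = trans (δ≡∑ (K r □ K t) S (combine a b)) (trans (∑-combine r t _)
    (sum-cong-≗ λ c → sum-cong-≗ λ d → cong (λ e → iverson (e ∧ h c d)) (K□K-adjacent a c b d)))
  corner : ∑[ c < r ] ∑[ d < t ] both c d ≡ 2 * iverson (h a b)
  corner = trans (sum-cong-≗ (λ c → ∑-if (α c) (λ d → if β d then 2 * iverson (h c d) else 0)))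
                 (trans (∑-δ a _) (∑-δ b (λ d → 2 * iverson (h a d))))
  row : ∑[ c < r ] ∑[ d < t ] inRow c d ≡ rowSum h a
  row = trans (sum-cong-≗ (λ c → ∑-if (α c) (λ d → iverson (h c d)))) (∑-δ a (rowSum h))
  col : ∑[ c < r ] ∑[ d < t ] inCol c d ≡ colSum h b
  col = sum-cong-≗ (λ c → ∑-δ b (λ d → iverson (h c d)))

-- Outside S the neighbourhood counts in S and in ∁ S add up to r + t − 2.
offensive-at⇔ : ∀ {r t} (S : Subset (r * t)) a b → cells r t S a b ≡ false →
  suc (δ (K r □ K t) (∁ S) (combine a b)) ≤ δ (K r □ K t) S (combine a b)
  ⇔ r + t ≤ 1 + 2 * crossSum (cells r t S) a b
offensive-at⇔ {r} {t} S a b out =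
  subst₂ (λ n m → suc δ̄ ≤ δS ⇔ n ≤ 1 + 2 * m) (sym total) δS≡ (1+n≤m⇔m+[n+2]≤1+2m δS δ̄)
  where
  δS = δ (K r □ K t) S (combine a b)
  δ̄  = δ (K r □ K t) (∁ S) (combine a b)
  δS≡ : δS ≡ crossSum (cells r t S) a b
  δS≡ = trans (sym (+-identityʳ δS))
              (subst (λ x → δS + 2 * iverson x ≡ crossSum (cells r t S) a b) out
                     (δ-K□K {r} {t} S a b))
  δ̄≡ : δ̄ + 2 ≡ crossSum (cells r t (∁ S)) a b
  δ̄≡ = subst (λ x → δ̄ + 2 * iverson x ≡ crossSum (cells r t (∁ S)) a b)
             (trans (cells-∁ S a b) (cong not out)) (δ-K□K {r} {t} (∁ S) a b)
  regroup : ∀ x y x̄ ȳ → (y + ȳ) + (x + x̄) ≡ (x + y) + (x̄ + ȳ)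
  regroup = solve-∀
  total : r + t ≡ δS + (δ̄ + 2)
  total = begin
    r + t
      ≡⟨ cong₂ _+_ (colSum-∁ {r} {t} S b) (rowSum-∁ {r} {t} S a) ⟨
    (colSum (cells r t S) b + colSum (cells r t (∁ S)) b)
      + (rowSum (cells r t S) a + rowSum (cells r t (∁ S)) a)
      ≡⟨ regroup (rowSum (cells r t S) a) (colSum (cells r t S) b)
                 (rowSum (cells r t (∁ S)) a) (colSum (cells r t (∁ S)) b) ⟩
    crossSum (cells r t S) a b + crossSum (cells r t (∁ S)) a b
      ≡⟨ cong₂ _+_ δS≡ δ̄≡ ⟨
    δS + (δ̄ + 2) ∎
    where open ≡-Reasoning

K□K-alliance⇔ : ∀ {r t} (S : Subset (r * t)) →
  IsGlobalOffensiveAlliance (K r □ K t) S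
  ⇔ (Nonempty S × (∀ a b → cells r t S a b ≡ false → r + t ≤ 1 + 2 * crossSum (cells r t S) a b))
K□K-alliance⇔ {r} {t} S = mk⇔
  (λ (nonempty , offensive) → nonempty , λ a b out →
     Equivalence.to (offensive-at⇔ {r} {t} S a b out) (offensive (combine a b) (lookup≡false⇒∉ out)))
  (λ (nonempty , attacked) → nonempty , λ v → subst (λ v → v ∉ S → Offensive v)
     (combine-remQuot {r} t v)
     (λ v∉S → let out = ∉⇒lookup≡false v∉S in
               Equivalence.from (offensive-at⇔ {r} {t} S _ _ out) (attacked _ _ out)))
  where
  Offensive : Fin (r * t) → Set
  Offensive v = suc (δ (K r □ K t) (∁ S) v) ≤ δ (K r □ K t) S v

alliance-lower-bound : ∀ {r t} {S : Subset (r * t)} p → IsGlobalOffensiveAlliance (K r □ K t) S →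
  (∀ z → r + t ≤ 1 + 2 * z → p ≤ 2 * z) → r * t * p ≤ 2 * (r + t) * ∣ S ∣
alliance-lower-bound {r} {t} {S} p alliance p≤ =
  subst (λ s → r * t * p ≤ 2 * (r + t) * s) (sym (∣S∣≡∑rowSum {r} {t} S))
    (counting-bound (cells r t S) p (p≤ (r + t) (m≤n⇒m≤1+n (m≤m+n (r + t) (r + t + 0))))
      (λ a b out → p≤ (crossSum (cells r t S) a b)
                       (proj₂ (Equivalence.to (K□K-alliance⇔ {r} {t} S) alliance) a b out)))

same-parity-lower-bound : ∀ {r t} {S : Subset (r * t)} .{{_ : NonZero r}} → r % 2 ≡ t % 2 →
  IsGlobalOffensiveAlliance (K r □ K t) S → r * t ≤ 2 * ∣ S ∣
same-parity-lower-bound {r} {t} {S} r≡t alliance =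
  *-cancelˡ-≤ (r + t) {{>-nonZero (≤-trans (>-nonZero⁻¹ r) (m≤m+n r t))}}
    (subst₂ _≤_ (*-comm (r * t) (r + t)) (swap (r + t) ∣ S ∣)
       (alliance-lower-bound {r} {t} (r + t) alliance even))
  where
  swap : ∀ n s → 2 * n * s ≡ n * (2 * s)
  swap = solve-∀
  even : ∀ z → r + t ≤ 1 + 2 * z → r + t ≤ 2 * z
  even z = subst (λ n → n ≤ 1 + 2 * z → n ≤ 2 * z) (sym (same-%2⇒+-even {r} {t} r≡t))
                 (2k≤1+2z⇒2k≤2z (r % 2 + (r / 2 + t / 2)) z)

-- The checkerboard

fromCells : ∀ {r t} → (Fin r → Fin t → Bool) → Subset (r * t)
fromCells {r} {t} h = tabulate (uncurry h ∘ remQuot {r} t)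

cells-fromCells : ∀ {r t} (h : Fin r → Fin t → Bool) a b → cells r t (fromCells h) a b ≡ h a b
cells-fromCells {r} {t} h a b =
  trans (lookup∘tabulate (uncurry h ∘ remQuot {r} t) (combine a b))
        (cong (uncurry h) (remQuot-combine a b))

sameParity : ∀ {r t} → Fin r → Fin t → Bool
sameParity a b = does (parity (toℕ a) ℙ.≟ parity (toℕ b))

checkerboard : ∀ r t → Subset (r * t)
checkerboard r t = fromCells {r} {t} sameParity

rowSum-checkerboard : ∀ {r t} a →
  rowSum (cells r t (checkerboard r t)) a ≡ parityCount t (parity (toℕ a))
rowSum-checkerboard {r} {t} a =
  sum-cong-≗ (λ d → cong iverson (cells-fromCells {r} {t} sameParity a d))

colSum-checkerboard : ∀ {r t} b →
  colSum (cells r t (checkerboard r t)) b ≡ parityCount r (parity (toℕ b))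
colSum-checkerboard {r} {t} b = sum-cong-≗ (λ (c : Fin r) → cong iverson
  (trans (cells-fromCells {r} {t} sameParity c b) (does-≟-comm (parity (toℕ c)) (parity (toℕ b)))))

checkerboard-attacks : ∀ r t p q → does (p ℙ.≟ q) ≡ false →
  r + t ≤ 1 + 2 * (parityCount t p + parityCount r q)
checkerboard-attacks r t 0ℙ 1ℙ _ rewrite parityCount-0ℙ t | parityCount-1ℙ r =
  subst (r + t ≤_) (collect ⌊ r /2⌋ ⌈ t /2⌉) (+-mono-≤ (n≤1+⌊n/2⌋+⌊n/2⌋ r) (n≤⌈n/2⌉+⌈n/2⌉ t))
  where
  collect : ∀ x y → suc (x + x) + (y + y) ≡ 1 + 2 * (y + x)
  collect = solve-∀
checkerboard-attacks r t 1ℙ 0ℙ _ rewrite parityCount-1ℙ t | parityCount-0ℙ r =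
  subst (r + t ≤_) (collect ⌈ r /2⌉ ⌊ t /2⌋) (+-mono-≤ (n≤⌈n/2⌉+⌈n/2⌉ r) (n≤1+⌊n/2⌋+⌊n/2⌋ t))
  where
  collect : ∀ x y → x + x + suc (y + y) ≡ 1 + 2 * (y + x)
  collect = solve-∀

checkerboard-nonempty : ∀ {r t} → 0 < r → 0 < t → Nonempty (checkerboard r t)
checkerboard-nonempty {suc r} {suc t} _ _ =
  combine {suc r} {suc t} zero zero ,
  lookup⇒[]= (combine {suc r} {suc t} zero zero) (checkerboard (suc r) (suc t))
             (cells-fromCells {suc r} {suc t} sameParity zero zero)

checkerboard-alliance : ∀ r t .{{_ : NonZero r}} .{{_ : NonZero t}} →
  IsGlobalOffensiveAlliance (K r □ K t) (checkerboard r t)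
checkerboard-alliance r t = Equivalence.from (K□K-alliance⇔ {r} {t} (checkerboard r t))
  (checkerboard-nonempty (>-nonZero⁻¹ r) (>-nonZero⁻¹ t) , attacked)
  where
  attacked : ∀ a b → cells r t (checkerboard r t) a b ≡ false →
    r + t ≤ 1 + 2 * crossSum (cells r t (checkerboard r t)) a b
  attacked a b out rewrite rowSum-checkerboard {r} {t} a | colSum-checkerboard {r} {t} b =
    checkerboard-attacks r t (parity (toℕ a)) (parity (toℕ b))
      (trans (sym (cells-fromCells {r} {t} sameParity a b)) out)

checkerboard-size : ∀ r t → 2 * ∣ checkerboard r t ∣ ≤ suc (r * t)
checkerboard-size r t =
  subst₂ (λ s m → 2 * s ≤ suc (r * m))
    (sym (trans (∣S∣≡∑rowSum {r} {t} (checkerboard r t)) (sum-cong-≗ (rowSum-checkerboard {r} {t}))))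
    halves
    (∑-parity-≤ r (parityCount t)
       (subst₂ (λ x y → x ≤ suc y) (sym (parityCount-0ℙ t)) (sym (parityCount-1ℙ t)) (⌈n/2⌉≤1+⌊n/2⌋ t)))
  where
  halves : parityCount t 0ℙ + parityCount t 1ℙ ≡ t
  halves = trans (cong₂ _+_ (parityCount-0ℙ t) (parityCount-1ℙ t))
                 (trans (+-comm ⌈ t /2⌉ ⌊ t /2⌋) (⌊n/2⌋+⌈n/2⌉≡n t))

proposition26 : (r t : ℕ) → .{{_ : NonZero r}} → .{{_ : NonZero t}} →
    (r % 2 ≡ t % 2 → IsGammaO (K r □ K t) ⌈ r * t / 2 ⌉)
    × (r % 2 ≢ t % 2 → ∀ k → IsGammaO (K r □ K t) k →
         ⌈ r * t * (r + t ∸ 1) / 2 * (r + t) ⌉ ≤ k × k ≤ ⌈ r * t / 2 ⌉)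
proposition26 r t = same-parity , opposite-parity
  where
  small : ∣ checkerboard r t ∣ ≤ ⌈ r * t / 2 ⌉
  small = ≤⌈/2⌉ (checkerboard-size r t)
  same-parity : r % 2 ≡ t % 2 → IsGammaO (K r □ K t) ⌈ r * t / 2 ⌉
  same-parity r≡t =
    ( checkerboard r t , checkerboard-alliance r t
    , ≤-antisym small (minimal (checkerboard-alliance r t)) ) ,
    λ _ → minimal
    where
    minimal : ∀ {S} → IsGlobalOffensiveAlliance (K r □ K t) S → ⌈ r * t / 2 ⌉ ≤ ∣ S ∣
    minimal alliance = ⌈/⌉≤ z<s (same-parity-lower-bound {r} {t} r≡t alliance)
  opposite-parity : r % 2 ≢ t % 2 → ∀ k → IsGammaO (K r □ K t) k →
    ⌈ r * t * (r + t ∸ 1) / 2 * (r + t) ⌉ ≤ k × k ≤ ⌈ r * t / 2 ⌉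
  opposite-parity _ _ ((S , alliance , refl) , minimum) =
    ⌈/⌉≤ (≤-trans (>-nonZero⁻¹ r) (≤-trans (m≤m+n r t) (m≤m+n (r + t) _)))
         (alliance-lower-bound {r} {t} (r + t ∸ 1) alliance (λ _ → ∸-monoˡ-≤ 1)) ,
    ≤-trans (minimum (checkerboard r t) (checkerboard-alliance r t)) small
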